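{- Let $G$ be a graph (multiple edges allowed, no loops) obtained from a bipartite graph by adding one edge. Then $L(G)$ has a proper Galvin orientation with respect to $\chi'(G)$. The same conclusion holds if, instead of a single edge, a multi-edge (a set of parallel edges between the same two vertices) is added to a bipartite graph, provided its multiplicity is at most $\lfloor\tfrac{\chi'(G)+1}{2}\rfloor$.
   Context: Graphs may have multiple edges but no loops. $\chi'(G)$ is the chromatic index of $G$. A $k$-edge-colouring is an assignment of colours from $\{1,\dots,k\}$ to edges so that adjacent edges get different colours. The line graph $L(G)$ has vertex set $E(G)$, and two edges $e,f$ of $G$ are joined in $L(G)$ by as many edges as the number of ends they share in $G$ (2 if parallel, 1 if adjacent but not parallel, 0 otherwise); thus each edge of $L(G)$ corresponds to a common incidence of its two ends at a vertex of $G$. Given a partition of $V(G)$ into sets $U$ and $D$ and a $k$-edge-colouring $\varphi$ of $G$, the Galvin orientation of $L(G)$ (with respect to $U,D,\varphi$) is defined as follows: for an edge of $L(G)$ with ends $e_1,e_2$, where $\varphi(e_1)<\varphi(e_2)$, corresponding to a common incidence at a vertex $x$ of $G$: if $x\in D$ it is oriented from $e_2$ to $e_1$, and if $x\in U$ it is oriented from $e_1$ to $e_2$. A kernel of a digraph is an independent set $K$ such that every vertex outside $K$ has an out-edge into $K$; a digraph is kernel-perfect if every induced subdigraph has a kernel. A Galvin orientation with respect to $U,D$ and a $k$-edge-colouring is proper if it is kernel-perfect and every vertex has outdegree at most $k-1$. $L(G)$ has a proper Galvin orientation with respect to $k$ if there exist a partition $(U,D)$ of $V(G)$ and a $k$-edge-colouring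 $\varphi$ of $G$ such that the corresponding Galvin orientation is proper. -}

module Defs where

open import Data.Nat using (ℕ; zero; suc; _+_; _∸_; _≤_)
open import Data.Nat.DivMod using (_/_)
open import Data.Fin using (Fin; zero; suc) renaming (_<_ to _<ᶠ_)
open import Data.Fin.Properties using (_≟_; _<?_)
open import Data.Fin.Subset using (Subset; _∈_; _∉_; ∣_∣)
open import Data.Bool using (Bool; true; false; if_then_else_)
open import Data.Product using (Σ; ∃; ∃-syntax; _×_; _,_)
open import Data.Sum using (_⊎_)
open import Relation.Binary.PropositionalEquality using (_≡_; _≢_)
open import Relation.Nullary using (Dec; ¬_; yes; no)
open import Relation.Nullary.Decidable using (⌊_⌋; _×-dec_; _⊎-dec_; ¬?)

record Multigraph (n m : ℕ) : Set where
  field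
    end₁ end₂ : Fin m → Fin n
    noLoop    : ∀ e → end₁ e ≢ end₂ e
open Multigraph public

module _ {n m : ℕ} (G : Multigraph n m) where

  Incident : Fin n → Fin m → Set
  Incident x e = x ≡ end₁ G e ⊎ x ≡ end₂ G e

  incident? : ∀ x e → Dec (Incident x e)
  incident? x e = (x ≟ end₁ G e) ⊎-dec (x ≟ end₂ G e)

  -- k-edge-colouring with colours Fin k (i.e. {1,…,k}, order preserved)
  IsEdgeColouring : (k : ℕ) → (Fin m → Fin k) → Set
  IsEdgeColouring k φ = ∀ e f x → e ≢ f → Incident x e → Incident x f → φ e ≢ φ f

  Colourable : ℕ → Set
  Colourable k = Σ (Fin m → Fin k) (IsEdgeColouring k)

  IsChromaticIndex : ℕ → Set
  IsChromaticIndex k = Colourable k × (∀ j → Colourable j → k ≤ j)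

data Side : Set where
  U D : Side

Oriented : ∀ {k} → Side → Fin k → Fin k → Set
Oriented D ce cf = cf <ᶠ ce
Oriented U ce cf = ce <ᶠ cf

oriented? : ∀ {k} s (ce cf : Fin k) → Dec (Oriented s ce cf)
oriented? D ce cf = cf <? ce
oriented? U ce cf = ce <? cf

module _ {n m : ℕ} (G : Multigraph n m) {k : ℕ}
         (side : Fin n → Side) (φ : Fin m → Fin k) where

  -- An arc e → f of the Galvin orientation of L(G), arising from the
  -- common incidence of e and f at vertex x.
  Arc : Fin m → Fin m → Fin n → Set
  Arc e f x = e ≢ f × Incident G x e × Incident G x f × Oriented (side x) (φ e) (φ f)

  arc? : ∀ e f x → Dec (Arc e f x)
  arc? e f x = ¬? (e ≟ f) ×-dec (incident? G x e ×-dec (incident? G x f ×-dec oriented? (side x) (φ e) (φ f)))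

  count : ∀ {A : Set} → Dec A → ℕ
  count (yes _) = 1
  count (no _)  = 0

  sumFin : ∀ {j} → (Fin j → ℕ) → ℕ
  sumFin {zero}  g = 0
  sumFin {suc j} g = g zero + sumFin (λ i → g (suc i))

  -- outdegree of e in L(G): arcs out of e, counted with multiplicity
  -- (each arc corresponds to a common incidence at an end of e; the two
  -- ends of e are distinct since there are no loops)
  outdeg : Fin m → ℕ
  outdeg e = sumFin (λ f → count (arc? e f (end₁ G e)) + count (arc? e f (end₂ G e)))

  IsKernel : Subset m → Subset m → Set
  IsKernel S K =
    (∀ e → e ∈ K → e ∈ S) ×
    (∀ e f x → e ∈ K → f ∈ K → ¬ Arc e f x) ×
    (∀ e → e ∈ S → e ∉ K → ∃[ f ] ∃[ x ] (f ∈ K × Arc e f x))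

  KernelPerfect : Set
  KernelPerfect = ∀ (S : Subset m) → ∃[ K ] IsKernel S K

  IsProperGalvin : Set
  IsProperGalvin = KernelPerfect × (∀ e → outdeg e ≤ k ∸ 1)

module _ {n m : ℕ} (G : Multigraph n m) where

  HasProperGalvinOrientation : ℕ → Set
  HasProperGalvinOrientation k =
    Σ (Fin n → Side) λ side → Σ (Fin m → Fin k) λ φ →
      IsEdgeColouring G k φ × IsProperGalvin G side φ

  BipartitePlusEdge : Set
  BipartitePlusEdge =
    Σ (Fin n → Bool) λ col → Σ (Fin m) λ e₀ →
      ∀ e → e ≢ e₀ → col (end₁ G e) ≢ col (end₂ G e)

  Joins : Fin n → Fin n → Fin m → Set
  Joins a b e = (end₁ G e ≡ a × end₂ G e ≡ b) ⊎ (end₁ G e ≡ b × end₂ G e ≡ a)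

  BipartitePlusMultiEdge : ℕ → Set
  BipartitePlusMultiEdge k =
    Σ (Fin n → Bool) λ col → Σ (Fin n) λ a → Σ (Fin n) λ b → Σ (Subset m) λ S →
      (∀ e → e ∈ S → Joins a b e) ×
      (∀ e → e ∉ S → col (end₁ G e) ≢ col (end₂ G e)) ×
      1 ≤ ∣ S ∣ × ∣ S ∣ ≤ (k + 1) / 2

module Submission where

-- Take the bipartition col under which only the edges of S are monochromatic,
-- and put the class of a into D and the other class into U.  Then no edge
-- lies inside U, and the edges inside D are exactly those of S.
--  * GalvinKernel: if no edge lies inside U and every edge g inside D
--    "covers" the edges of smaller colour at its ends, the Galvin orientation
--    is kernel-perfect.  The unbeaten edges of a set form its kernel, unless
--    an arc joins two of them; then one is removed and we recurse.
--  * LowestColours: transpositions of colours turn any proper k-colouring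
--    into one in which the edges of S carry the colours below some t ≤ |S|,
--    and no other edge at a or b does.  This yields the covering condition.
--  * OutDegree: in a proper colouring an edge of colour c has at most c arcs
--    at an end in D and k - 1 - c at an end in U.  An edge inside D lies in S,
--    so c < |S| ≤ ⌊(k+1)/2⌋ and 2c ≤ k - 1.
-- The single-edge case is the bundle S = {e₀}.

open import Defs
open import Data.Nat using (ℕ)
open import Data.Product using (_×_)

open import Data.Bool using (Bool; true)
import Data.Bool.Properties as Bool
open import Data.Empty renaming (⊥ to Empty) using (⊥-elim)
open import Data.Fin as Fin using (Fin; zero; suc; toℕ; punchIn; punchOut; fromℕ<)
  renaming (_<_ to _<ᶠ_; _≤_ to _≤ᶠ_)
open import Data.Fin.Induction using (<-wellFounded)
import Data.Fin.Permutation.Components as Colours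
open import Data.Fin.Properties as Fin using (suc-injective; punchIn-punchOut; punchOut-injective; _<?_; any?)
open import Data.Fin.Subset using (Subset; _∈_; _∉_; _⊂_; _⊃_; _⊆_; _∪_; ⁅_⁆; ∣_∣; ⊥)
open import Data.Fin.Subset.Induction using (Acc; acc; ⊂-wellFounded; ⊃-wellFounded)
open import Data.Fin.Subset.Properties
  using (_∈?_; x∈p∪q⁺; x∈p∪q⁻; p⊆p∪q; x∈⁅x⁆; x∈⁅y⁆⇒x≡y; p⊂q⇒∣p∣<∣q∣; p⊆q⇒∣p∣≤∣q∣; ∉⊥;
         ∣⁅x⁆∣≡1)
open import Data.Nat as ℕ using (zero; suc; z≤n; s≤s; _+_; _*_; _∸_; _≤_; _<_)
open import Data.Nat.DivMod using (_/_; m/n*n≤m; m≥n⇒m/n>0)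
import Data.Nat.Properties as ℕ
open import Algebra.Properties.CommutativeMonoid.Sum ℕ.+-0-commutativeMonoid
  using (sum; sum-remove; sum-cong-≗; ∑-distrib-+)
open import Data.Product using (Σ; ∃-syntax; _,_; proj₁; proj₂)
open import Data.Sum using (_⊎_; inj₁; inj₂)
open import Data.Vec using (tabulate)
open import Data.Vec.Properties using (lookup∘tabulate; lookup⇒[]=; []=⇒lookup)
open import Function using (_∘_; case_of_)
open import Level using (0ℓ)
open import Relation.Binary.PropositionalEquality
  using (_≡_; _≢_; refl; sym; trans; cong; cong₂; subst; module ≡-Reasoning)
open import Relation.Nullary using (Dec; yes; no; ¬_; does)
open import Relation.Nullary.Decidable using (dec-true; dec-false; _×-dec_; ¬?)
open import Relation.Unary using (Pred; Decidable)

indicator : ∀ {A : Set} → Dec A → ℕ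
indicator (yes _) = 1
indicator (no _)  = 0

indicator-yes : ∀ {A : Set} (a? : Dec A) → A → indicator a? ≡ 1
indicator-yes (yes _) _ = refl
indicator-yes (no ¬a) a = ⊥-elim (¬a a)

indicator-cong : ∀ {A B : Set} (a? : Dec A) (b? : Dec B) → (A → B) → (B → A) → indicator a? ≡ indicator b?
indicator-cong (yes _) (yes _) _   _   = refl
indicator-cong (yes a) (no ¬b) a→b _   = ⊥-elim (¬b (a→b a))
indicator-cong (no ¬a) (yes b) _   b→a = ⊥-elim (¬a (b→a b))
indicator-cong (no _)  (no _)  _   _   = refl

♯ : ∀ {j} {P : Pred (Fin j) 0ℓ} → Decidable P → ℕ
♯ P? = sum (λ i → indicator (P? i))

♯-cong : ∀ {j} {P Q : Pred (Fin j) 0ℓ} (P? : Decidable P) (Q? : Decidable Q) →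
         (∀ i → P i → Q i) → (∀ i → Q i → P i) → ♯ P? ≡ ♯ Q?
♯-cong P? Q? to from = sum-cong-≗ (λ i → indicator-cong (P? i) (Q? i) (to i) (from i))

♯-empty : ∀ {j} {P : Pred (Fin j) 0ℓ} (P? : Decidable P) → (∀ i → ¬ P i) → ♯ P? ≡ 0
♯-empty {zero}  P? none = refl
♯-empty {suc j} P? none with P? zero
... | yes p = ⊥-elim (none zero p)
... | no  _ = ♯-empty (P? ∘ suc) (none ∘ suc)

♯-full : ∀ {j} {P : Pred (Fin j) 0ℓ} (P? : Decidable P) → (∀ i → P i) → ♯ P? ≡ j
♯-full {zero}  P? all = refl
♯-full {suc j} P? all = cong₂ _+_ (indicator-yes (P? zero) (all zero)) (♯-full (P? ∘ suc) (all ∘ suc))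

♯-remove : ∀ {k} {Q : Pred (Fin (suc k)) 0ℓ} (Q? : Decidable Q) (c : Fin (suc k)) → Q c →
           ♯ Q? ≡ suc (♯ (Q? ∘ punchIn c))
♯-remove Q? c q = trans (sum-remove {i = c} (λ i → indicator (Q? i)))
                        (cong (_+ ♯ (Q? ∘ punchIn c)) (indicator-yes (Q? c) q))

♯-injection : ∀ {j k} {P : Pred (Fin j) 0ℓ} {Q : Pred (Fin k) 0ℓ} (P? : Decidable P) (Q? : Decidable Q)
              (g : ∀ i → P i → Fin k) → (∀ i p → Q (g i p)) →
              (∀ i i′ p p′ → g i p ≡ g i′ p′ → i ≡ i′) → ♯ P? ≤ ♯ Q?
♯-injection {k = zero} P? Q? g into inj = ℕ.≤-reflexive (♯-empty P? (λ i p → Fin0-empty (g i p)))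
  where
  Fin0-empty : ¬ Fin 0
  Fin0-empty ()
♯-injection {zero} {suc k} P? Q? g into inj = z≤n
♯-injection {suc j} {suc k} {Q = Q} P? Q? g into inj with P? zero
... | no _ = ♯-injection (P? ∘ suc) Q? (g ∘ suc) (into ∘ suc)
               (λ i i′ p p′ eq → suc-injective (inj _ _ p p′ eq))
... | yes p₀ = ℕ.≤-trans (s≤s rest) (ℕ.≤-reflexive (sym (♯-remove Q? c (into zero p₀))))
  where
  c = g zero p₀
  avoid : ∀ i p → c ≢ g (suc i) p
  avoid i p eq with inj zero (suc i) p₀ p eq
  ... | ()
  rest : ♯ (P? ∘ suc) ≤ ♯ (Q? ∘ punchIn c)
  rest = ♯-injection (P? ∘ suc) (Q? ∘ punchIn c) (λ i p → punchOut (avoid i p))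
           (λ i p → subst Q (sym (punchIn-punchOut (avoid i p))) (into (suc i) p))
           (λ i i′ p p′ eq → suc-injective (inj _ _ p p′ (punchOut-injective (avoid i p) (avoid i′ p′) eq)))

♯-below : ∀ {k} (c : Fin k) → ♯ (λ (d : Fin k) → d <? c) ≡ toℕ c
♯-below {suc k} zero = ♯-empty (λ (d : Fin (suc k)) → d <? zero {k}) (λ (d : Fin (suc k)) ())
♯-below {suc k} (suc c) = cong suc (trans (♯-cong (λ (d : Fin k) → suc d <? suc c) (λ d → d <? c)
                                               (λ _ → ℕ.≤-pred) (λ _ → s≤s)) (♯-below c))

♯-above : ∀ {k} (c : Fin k) → ♯ (λ (d : Fin k) → c <? d) ≡ k ∸ suc (toℕ c)
♯-above {suc k} zero = ♯-full (λ (d : Fin k) → zero {k} <? suc d) (λ (d : Fin k) → s≤s z≤n)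
♯-above {suc k} (suc c) = trans (♯-cong (λ (d : Fin k) → suc c <? suc d) (λ d → c <? d)
                                         (λ _ → ℕ.≤-pred) (λ _ → s≤s)) (♯-above c)

subsetOf : ∀ {m} {P : Pred (Fin m) 0ℓ} → Decidable P → Subset m
subsetOf P? = tabulate (λ i → does (P? i))

∈-subsetOf⁺ : ∀ {m} {P : Pred (Fin m) 0ℓ} (P? : Decidable P) {i} → P i → i ∈ subsetOf P?
∈-subsetOf⁺ P? {i} p = lookup⇒[]= i _ (trans (lookup∘tabulate _ i) (dec-true (P? i) p))

∈-subsetOf⁻ : ∀ {m} {P : Pred (Fin m) 0ℓ} (P? : Decidable P) {i} → i ∈ subsetOf P? → P i
∈-subsetOf⁻ P? {i} i∈ = witness (P? i) (trans (sym (lookup∘tabulate _ i)) ([]=⇒lookup i∈))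
  where
  witness : ∀ {A : Set} (a? : Dec A) → does a? ≡ true → A
  witness (yes a) _ = a
  witness (no _) ()

insert-⊂ : ∀ {m} {T : Subset m} {e} → e ∉ T → T ⊂ T ∪ ⁅ e ⁆
insert-⊂ {e = e} e∉T = p⊆p∪q ⁅ e ⁆ , e , x∈p∪q⁺ (inj₂ (x∈⁅x⁆ e)) , e∉T

insert-⊆ : ∀ {m} {S T : Subset m} {e} → T ⊆ S → e ∈ S → T ∪ ⁅ e ⁆ ⊆ S
insert-⊆ {T = T} {e} T⊆S e∈S f∈ with x∈p∪q⁻ T ⁅ e ⁆ f∈
... | inj₁ f∈T = T⊆S f∈T
... | inj₂ f∈e rewrite x∈⁅y⁆⇒x≡y e f∈e = e∈S

ends-agree : ∀ {n m} (G : Multigraph n m) {A : Set} (F : Fin n → A) {g x y} →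
             Incident G x g → Incident G y g → x ≢ y → F x ≡ F y → F (end₁ G g) ≡ F (end₂ G g)
ends-agree G F (inj₁ refl) (inj₂ refl) _ eq = eq
ends-agree G F (inj₂ refl) (inj₁ refl) _ eq = sym eq
ends-agree G F (inj₁ refl) (inj₁ refl) x≢y _ = ⊥-elim (x≢y refl)
ends-agree G F (inj₂ refl) (inj₂ refl) x≢y _ = ⊥-elim (x≢y refl)

module OutDegree {n m : ℕ} (G : Multigraph n m) {k : ℕ} (side : Fin n → Side) (φ : Fin m → Fin k) where

  -- The number of colours that an arc leaving an edge of colour c can
  -- reach at a vertex on the given side: those below c at D, above c at U.
  budget : Side → Fin k → ℕ
  budget s c = ♯ (oriented? s c)

  budget-D : ∀ c → budget D c ≡ toℕ c
  budget-D = ♯-below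

  budget-U : ∀ c → budget U c ≡ k ∸ suc (toℕ c)
  budget-U = ♯-above

  outdeg-split : ∀ e → outdeg G side φ e ≡
                 ♯ (λ f → arc? G side φ e f (end₁ G e)) + ♯ (λ f → arc? G side φ e f (end₂ G e))
  outdeg-split e = begin
    sumFin G side φ (λ f → count G side φ (at₁ f) + count G side φ (at₂ f))
      ≡⟨ sumFin≡sum {m} (λ f → count G side φ (at₁ f) + count G side φ (at₂ f)) ⟩
    sum (λ f → count G side φ (at₁ f) + count G side φ (at₂ f))
      ≡⟨ sum-cong-≗ (λ f → cong₂ _+_ (count≡indicator (at₁ f)) (count≡indicator (at₂ f))) ⟩
    sum (λ f → indicator (at₁ f) + indicator (at₂ f))
      ≡⟨ ∑-distrib-+ (λ f → indicator (at₁ f)) (λ f → indicator (at₂ f)) ⟩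
    ♯ at₁ + ♯ at₂ ∎
    where
    open ≡-Reasoning
    at₁ = λ f → arc? G side φ e f (end₁ G e)
    at₂ = λ f → arc? G side φ e f (end₂ G e)
    count≡indicator : ∀ {A : Set} (a? : Dec A) → count G side φ a? ≡ indicator a?
    count≡indicator (yes _) = refl
    count≡indicator (no _)  = refl
    sumFin≡sum : ∀ {j} (h : Fin j → ℕ) → sumFin G side φ h ≡ sum h
    sumFin≡sum {zero}  h = refl
    sumFin≡sum {suc j} h = cong (h zero +_) (sumFin≡sum (h ∘ suc))

  -- In a proper colouring, the arcs leaving e at x go to edges of pairwise
  -- distinct colours, all admissible for the side of x.
  arcs-at : IsEdgeColouring G k φ → ∀ e x → ♯ (λ f → arc? G side φ e f x) ≤ budget (side x) (φ e)
  arcs-at proper e x = ♯-injection (λ f → arc? G side φ e f x) (oriented? (side x) (φ e))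
    (λ f _ → φ f) (λ f arc → proj₂ (proj₂ (proj₂ arc))) distinct
    where
    distinct : ∀ f f′ → Arc G side φ e f x → Arc G side φ e f′ x → φ f ≡ φ f′ → f ≡ f′
    distinct f f′ (_ , _ , x∼f , _) (_ , _ , x∼f′ , _) same with f Fin.≟ f′
    ... | yes f≡f′ = f≡f′
    ... | no  f≢f′ = ⊥-elim (proper f f′ x f≢f′ x∼f x∼f′ same)

  outdeg-bound : IsEdgeColouring G k φ → ∀ e →
                 outdeg G side φ e ≤ budget (side (end₁ G e)) (φ e) + budget (side (end₂ G e)) (φ e)
  outdeg-bound proper e = ℕ.≤-trans (ℕ.≤-reflexive (outdeg-split e))
                            (ℕ.+-mono-≤ (arcs-at proper e (end₁ G e)) (arcs-at proper e (end₂ G e)))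

oriented-D : ∀ {k s} {c d : Fin k} → s ≡ D → Oriented s c d → d <ᶠ c
oriented-D refl o = o

oriented-U : ∀ {k s} {c d : Fin k} → s ≡ U → Oriented s c d → c <ᶠ d
oriented-U refl o = o

toOriented-D : ∀ {k s} {c d : Fin k} → s ≡ D → d <ᶠ c → Oriented s c d
toOriented-D refl o = o

toOriented-U : ∀ {k s} {c d : Fin k} → s ≡ U → c <ᶠ d → Oriented s c d
toOriented-U refl o = o

side-cases : ∀ s → s ≡ U ⊎ s ≡ D
side-cases U = inj₁ refl
side-cases D = inj₂ refl

isD? : ∀ s → Dec (s ≡ D)
isD? U = no λ ()
isD? D = yes refl

sideOf : ∀ {A : Set} → Dec A → Side
sideOf (yes _) = D
sideOf (no _)  = U

sideOf-D : ∀ {A : Set} (a? : Dec A) → sideOf a? ≡ D → A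
sideOf-D (yes a) _ = a
sideOf-D (no _) ()

sideOf-U : ∀ {A : Set} (a? : Dec A) → sideOf a? ≡ U → ¬ A
sideOf-U (yes _) ()
sideOf-U (no ¬a) _ = ¬a

sideOf-yes : ∀ {A : Set} (a? : Dec A) → A → sideOf a? ≡ D
sideOf-yes (yes _) _ = refl
sideOf-yes (no ¬a) a = ⊥-elim (¬a a)

NoEdgeInsideU : ∀ {n m} → Multigraph n m → (Fin n → Side) → Set
NoEdgeInsideU G side =
  ∀ e x y → Incident G x e → Incident G y e → x ≢ y → side x ≡ U → side y ≡ U → Empty

DDEdgesCoverLower : ∀ {n m k} → Multigraph n m → (Fin n → Side) → (Fin m → Fin k) → Set
DDEdgesCoverLower G side φ =
  ∀ g h x y → Incident G x g → Incident G y g → x ≢ y → side x ≡ D → side y ≡ D →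
  Incident G y h → φ h <ᶠ φ g → Incident G x h

module GalvinKernel {n m : ℕ} (G : Multigraph n m) {k : ℕ} (side : Fin n → Side) (φ : Fin m → Fin k)
  (noEdgeInsideU : NoEdgeInsideU G side) (coverLower : DDEdgesCoverLower G side φ) where

  Beaten : Subset m → Fin m → Set
  Beaten S e = ∃[ g ] ∃[ x ] (g ∈ S × side x ≡ D × Incident G x e × Incident G x g × φ g <ᶠ φ e)

  beaten? : ∀ S e → Dec (Beaten S e)
  beaten? S e = any? λ g → any? λ x →
    (g ∈? S) ×-dec (isD? (side x) ×-dec (incident? G x e ×-dec (incident? G x g ×-dec (φ g <? φ e))))

  unbeaten? : ∀ S e → Dec (e ∈ S × ¬ Beaten S e)
  unbeaten? S e = (e ∈? S) ×-dec ¬? (beaten? S e)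

  Unbeaten : Subset m → Subset m
  Unbeaten S = subsetOf (unbeaten? S)

  -- Below any edge of S at a D-vertex x lies an unbeaten edge of S at x:
  -- the edge beating g meets x too, directly or by coverLower.
  descend : ∀ S {x} → side x ≡ D → ∀ g → Acc _<ᶠ_ (φ g) → g ∈ S → Incident G x g →
            ∃[ g′ ] (g′ ∈ Unbeaten S × Incident G x g′ × φ g′ ≤ᶠ φ g)
  descend S {x} sx g (acc below) g∈S x∼g with beaten? S g
  ... | no unbeaten = g , ∈-subsetOf⁺ (unbeaten? S) (g∈S , unbeaten) , x∼g , ℕ.≤-refl
  ... | yes (h , y , h∈S , sy , y∼g , y∼h , h<g) =
    let (g′ , g′∈ , x∼g′ , g′≤h) = descend S sx h (below h<g) h∈S x∼h
    in g′ , g′∈ , x∼g′ , ℕ.≤-trans g′≤h (ℕ.<⇒≤ h<g)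
    where
    x∼h : Incident G x h
    x∼h with y Fin.≟ x
    ... | yes refl = y∼h
    ... | no  y≢x  = coverLower g h x y x∼g y∼g (y≢x ∘ sym) sx sy y∼h h<g

  unbeaten-kernel : ∀ S → (∀ e f x → e ∈ Unbeaten S → f ∈ Unbeaten S → ¬ Arc G side φ e f x) →
                    IsKernel G side φ S (Unbeaten S)
  unbeaten-kernel S independent = (λ e e∈ → proj₁ (∈-subsetOf⁻ (unbeaten? S) e∈)) , independent , absorb
    where
    absorb : ∀ e → e ∈ S → e ∉ Unbeaten S → ∃[ f ] ∃[ x ] (f ∈ Unbeaten S × Arc G side φ e f x)
    absorb e e∈S e∉ with beaten? S e
    ... | no  unbeaten = ⊥-elim (e∉ (∈-subsetOf⁺ (unbeaten? S) (e∈S , unbeaten)))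
    ... | yes (g , x , g∈S , sx , x∼e , x∼g , g<e) =
      let (g′ , g′∈ , x∼g′ , g′≤g) = descend S sx g (<-wellFounded (φ g)) g∈S x∼g
          g′<e = ℕ.≤-<-trans g′≤g g<e
      in g′ , x , g′∈ , (λ e≡g′ → Fin.<-irrefl (cong φ (sym e≡g′)) g′<e) ,
         x∼e , x∼g′ , toOriented-D sx g′<e

  -- An arc at a D-vertex from an unbeaten edge would go to an edge of S
  -- beating it; so arcs out of unbeaten edges towards S lie at U-vertices.
  unbeaten-arc-at-U : ∀ S {e₁ e₂ x} → e₁ ∈ Unbeaten S → e₂ ∈ S → Arc G side φ e₁ e₂ x →
                      side x ≡ U
  unbeaten-arc-at-U S {e₁} {e₂} {x} e₁∈ e₂∈S (_ , x∼e₁ , x∼e₂ , o) with side-cases (side x)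
  ... | inj₁ x∈U = x∈U
  ... | inj₂ x∈D = ⊥-elim (proj₂ (∈-subsetOf⁻ (unbeaten? S) e₁∈)
                                 (e₂ , x , e₂∈S , x∈D , x∼e₁ , x∼e₂ , oriented-D x∈D o))

  without? : ∀ (S : Subset m) (e f : Fin m) → Dec (f ∈ S × f ≢ e)
  without? S e f = (f ∈? S) ×-dec ¬? (f Fin.≟ e)

  _without_ : Subset m → Fin m → Subset m
  S without e = subsetOf (without? S e)

  without-⊂ : ∀ S {e} → e ∈ S → S without e ⊂ S
  without-⊂ S {e} e∈S = (λ f∈ → proj₁ (∈-subsetOf⁻ (without? S e) f∈)) ,
                        e , e∈S , (λ e∈ → proj₂ (∈-subsetOf⁻ (without? S e) e∈) refl)

  -- An arc e₁ → e₂ between unbeaten edges lies at a U-vertex x, and then a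
  -- kernel of S without e₁ also absorbs e₁: either e₂ is in it, or the edge
  -- absorbing e₂ does so at x (a D-vertex would beat e₂; another U-vertex
  -- would make e₂ an edge inside U) and then also absorbs e₁.
  extend-kernel : ∀ S {e₁ e₂ x} → e₁ ∈ Unbeaten S → e₂ ∈ Unbeaten S → Arc G side φ e₁ e₂ x →
                  ∀ K → IsKernel G side φ (S without e₁) K → IsKernel G side φ S K
  extend-kernel S {e₁} {e₂} {x} e₁∈ e₂∈ arc@(e₁≢e₂ , x∼e₁ , x∼e₂ , o) K
                (K⊆S∖e₁ , independent , absorb′) = K⊆S , independent , absorb
    where
    e₂∈S : e₂ ∈ S
    e₂∈S = proj₁ (∈-subsetOf⁻ (unbeaten? S) e₂∈)
    e₂-unbeaten : ¬ Beaten S e₂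
    e₂-unbeaten = proj₂ (∈-subsetOf⁻ (unbeaten? S) e₂∈)
    K⊆S : ∀ f → f ∈ K → f ∈ S
    K⊆S f f∈K = proj₁ (∈-subsetOf⁻ (without? S e₁) (K⊆S∖e₁ f f∈K))
    x∈U : side x ≡ U
    x∈U = unbeaten-arc-at-U S e₁∈ e₂∈S arc
    absorb-e₁ : ∃[ f ] ∃[ y ] (f ∈ K × Arc G side φ e₁ f y)
    absorb-e₁ with e₂ ∈? K
    ... | yes e₂∈K = e₂ , x , e₂∈K , arc
    ... | no  e₂∉K with absorb′ e₂ (∈-subsetOf⁺ (without? S e₁) (e₂∈S , e₁≢e₂ ∘ sym)) e₂∉K
    ...   | (f , y , f∈K , _ , y∼e₂ , y∼f , o₂) with side-cases (side y)
    ...     | inj₂ sy = ⊥-elim (e₂-unbeaten (f , y , K⊆S f f∈K , sy , y∼e₂ , y∼f , oriented-D sy o₂))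
    ...     | inj₁ sy with y Fin.≟ x
    ...       | no  y≢x  = ⊥-elim (noEdgeInsideU e₂ y x y∼e₂ x∼e₂ y≢x sy x∈U)
    ...       | yes refl = f , y , f∈K , e₁≢f , x∼e₁ , y∼f ,
                           toOriented-U x∈U (Fin.<-trans (oriented-U x∈U o) (oriented-U sy o₂))
      where
      e₁≢f : e₁ ≢ f
      e₁≢f e₁≡f = proj₂ (∈-subsetOf⁻ (without? S e₁) (K⊆S∖e₁ f f∈K)) (sym e₁≡f)
    absorb : ∀ e → e ∈ S → e ∉ K → ∃[ f ] ∃[ y ] (f ∈ K × Arc G side φ e f y)
    absorb e e∈S e∉K with e Fin.≟ e₁
    ... | no  e≢e₁ = absorb′ e (∈-subsetOf⁺ (without? S e₁) (e∈S , e≢e₁)) e∉K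
    ... | yes refl = absorb-e₁

  kernel : ∀ S → Acc _⊂_ S → ∃[ K ] IsKernel G side φ S K
  kernel S (acc smaller) with any? (λ e₁ → any? (λ e₂ → any? (λ x →
                              (e₁ ∈? Unbeaten S) ×-dec ((e₂ ∈? Unbeaten S) ×-dec arc? G side φ e₁ e₂ x))))
  ... | no noArc = Unbeaten S , unbeaten-kernel S (λ e f x e∈ f∈ a → noArc (e , f , x , e∈ , f∈ , a))
  ... | yes (e₁ , e₂ , x , e₁∈ , e₂∈ , a) =
    let e₁∈S = proj₁ (∈-subsetOf⁻ (unbeaten? S) e₁∈)
        (K , isKernel) = kernel (S without e₁) (smaller (without-⊂ S e₁∈S))
    in K , extend-kernel S e₁∈ e₂∈ a K isKernel

  kernelPerfect : KernelPerfect G side φ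
  kernelPerfect S = kernel S (⊂-wellFounded S)

module _ {k : ℕ} (i j : Fin k) where

  swap : Fin k → Fin k
  swap = Colours.transpose i j

  swap-injective : ∀ c d → swap c ≡ swap d → c ≡ d
  swap-injective c d eq = begin
    c                               ≡⟨ Colours.transpose-inverse j i ⟨
    Colours.transpose j i (swap c)  ≡⟨ cong (Colours.transpose j i) eq ⟩
    Colours.transpose j i (swap d)  ≡⟨ Colours.transpose-inverse j i ⟩
    d                               ∎
    where open ≡-Reasoning

  swap-i : swap i ≡ j
  swap-i rewrite dec-true (i Fin.≟ i) refl = refl

  swap-j : swap j ≡ i
  swap-j with j Fin.≟ i
  ... | yes refl = refl
  ... | no  _ rewrite dec-true (j Fin.≟ j) refl = refl

  swap-other : ∀ c → c ≢ i → c ≢ j → swap c ≡ c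
  swap-other c c≢i c≢j rewrite dec-false (c Fin.≟ i) c≢i | dec-false (c Fin.≟ j) c≢j = refl

recolour-proper : ∀ {n m k} (G : Multigraph n m) {φ : Fin m → Fin k} (π : Fin k → Fin k) →
                  (∀ c d → π c ≡ π d → c ≡ d) → IsEdgeColouring G k φ → IsEdgeColouring G k (π ∘ φ)
recolour-proper G π π-inj proper e f x e≢f x∼e x∼f same = proper e f x e≢f x∼e x∼f (π-inj _ _ same)

-- Recolouring so that a bundle S of parallel edges between a and b gets
-- the lowest colours: one transposition of colours per edge of S.
module LowestColours {n m : ℕ} (G : Multigraph n m) (a b : Fin n) (S : Subset m)
  (a∼S : ∀ e → e ∈ S → Incident G a e) (b∼S : ∀ e → e ∈ S → Incident G b e) where

  MeetsAB : Fin m → Set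
  MeetsAB h = Incident G a h ⊎ Incident G b h

  sole : ∀ {k} {φ : Fin m → Fin k} → IsEdgeColouring G k φ →
         ∀ e h → e ∈ S → MeetsAB h → φ h ≡ φ e → h ≡ e
  sole proper e h e∈S h∼ab same with h Fin.≟ e
  ... | yes h≡e = h≡e
  ... | no  h≢e with h∼ab
  ...   | inj₁ a∼h = ⊥-elim (proper h e a h≢e a∼h (a∼S e e∈S) same)
  ...   | inj₂ b∼h = ⊥-elim (proper h e b h≢e b∼h (b∼S e e∈S) same)

  record LowOn {k} (φ : Fin m → Fin k) (T : Subset m) (t : ℕ) : Set where
    field
      proper  : IsEdgeColouring G k φ
      t≤∣T∣   : t ≤ ∣ T ∣
      T-below : ∀ e → e ∈ T → toℕ (φ e) < t
      below-T : ∀ h → MeetsAB h → toℕ (φ h) < t → h ∈ T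

  -- One step: an edge e of S outside T is brought down to colour t by
  -- swapping its colour with t.
  module Step {k} {φ : Fin m → Fin k} {T t} (low : LowOn φ T t) (e : Fin m) (e∈S : e ∈ S) (e∉T : e ∉ T) where
    open LowOn low

    -- e is not low yet, so its colour is at least t; in particular t < k.
    t≤φe : t ≤ toℕ (φ e)
    t≤φe = ℕ.≮⇒≥ (λ φe<t → e∉T (below-T e (inj₁ (a∼S e e∈S)) φe<t))
    t<k : t < k
    t<k = ℕ.≤-<-trans t≤φe (Fin.toℕ<n (φ e))
    c : Fin k
    c = fromℕ< t<k
    toℕc : toℕ c ≡ t
    toℕc = Fin.toℕ-fromℕ< t<k

    ψ : Fin m → Fin k
    ψ = swap (φ e) c ∘ φ
    T′ : Subset m
    T′ = T ∪ ⁅ e ⁆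

    -- Edges of T keep their colours (below t, hence neither φ e nor t);
    -- e now has colour t.
    T-below′ : ∀ f → f ∈ T′ → toℕ (ψ f) < suc t
    T-below′ f f∈T′ with x∈p∪q⁻ T ⁅ e ⁆ f∈T′
    ... | inj₂ f∈e rewrite x∈⁅y⁆⇒x≡y e f∈e | swap-i (φ e) c = s≤s (ℕ.≤-reflexive toℕc)
    ... | inj₁ f∈T =
      ℕ.m≤n⇒m≤1+n (subst (λ d → toℕ d < t) (sym (swap-other (φ e) c (φ f) f≢e f≢c)) φf<t)
      where
      φf<t = T-below f f∈T
      f≢e : φ f ≢ φ e
      f≢e eq = ℕ.<-irrefl (cong toℕ eq) (ℕ.<-≤-trans φf<t t≤φe)
      f≢c : φ f ≢ c
      f≢c eq = ℕ.<-irrefl (trans (cong toℕ eq) toℕc) φf<t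
    -- An edge at a or b with new colour at most t had old colour φ e (so it
    -- is e; old colour t is impossible as t ≤ φ e) or an old colour below t.
    below-T′ : ∀ h → MeetsAB h → toℕ (ψ h) < suc t → h ∈ T′
    below-T′ h h∼ab lt = by-colour (φ h Fin.≟ φ e) (φ h Fin.≟ c)
      where
      by-colour : Dec (φ h ≡ φ e) → Dec (φ h ≡ c) → h ∈ T′
      by-colour (yes h≡e) _ rewrite sole proper e h e∈S h∼ab h≡e = x∈p∪q⁺ (inj₂ (x∈⁅x⁆ e))
      by-colour (no h≢e) (yes h≡c) =
        ⊥-elim (h≢e (trans h≡c (Fin.toℕ-injective (trans toℕc (ℕ.≤-antisym t≤φe (ℕ.≤-pred φe<1+t))))))
        where
        φe<1+t : toℕ (φ e) < suc t
        φe<1+t = subst (λ d → toℕ d < suc t) (trans (cong (swap (φ e) c) h≡c) (swap-j (φ e) c)) lt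
      by-colour (no h≢e) (no h≢c) = x∈p∪q⁺ (inj₁ (below-T h h∼ab φh<t))
        where
        φh<1+t : toℕ (φ h) < suc t
        φh<1+t = subst (λ d → toℕ d < suc t) (swap-other (φ e) c (φ h) h≢e h≢c) lt
        φh<t : toℕ (φ h) < t
        φh<t = ℕ.≤∧≢⇒< (ℕ.≤-pred φh<1+t) (λ eq → h≢c (Fin.toℕ-injective (trans eq (sym toℕc))))

    lowOn : LowOn ψ T′ (suc t)
    lowOn = record
      { proper  = recolour-proper G (swap (φ e) c) (swap-injective (φ e) c) proper
      ; t≤∣T∣   = ℕ.≤-trans (s≤s t≤∣T∣) (p⊂q⇒∣p∣<∣q∣ (insert-⊂ e∉T))
      ; T-below = T-below′
      ; below-T = below-T′
      }

  grow : ∀ {k} {φ : Fin m → Fin k} {T t} → T ⊆ S → LowOn φ T t → Acc _⊃_ T →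
         Σ (Fin m → Fin k) λ ψ → Σ ℕ λ s → LowOn ψ S s
  grow {φ = φ} {T} {t} T⊆S low (acc larger) with any? (λ e → (e ∈? S) ×-dec ¬? (e ∈? T))
  ... | yes (e , e∈S , e∉T) =
    grow (insert-⊆ T⊆S e∈S) (Step.lowOn low e e∈S e∉T) (larger (insert-⊂ e∉T))
  ... | no none = φ , t , record
    { proper  = proper
    ; t≤∣T∣   = ℕ.≤-trans t≤∣T∣ (p⊆q⇒∣p∣≤∣q∣ T⊆S)
    ; T-below = λ e e∈S → T-below e (S⊆T e∈S)
    ; below-T = λ h h∼ab lt → T⊆S (below-T h h∼ab lt)
    }
    where
    open LowOn low
    S⊆T : S ⊆ T
    S⊆T {e} e∈S with e ∈? T
    ... | yes e∈T = e∈T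
    ... | no  e∉T = ⊥-elim (none (e , e∈S , e∉T))

  lowestColours : ∀ {k} {φ : Fin m → Fin k} → IsEdgeColouring G k φ →
                  Σ (Fin m → Fin k) λ ψ → Σ ℕ λ s → LowOn ψ S s
  lowestColours {φ = φ} proper = grow (λ e∈ → ⊥-elim (∉⊥ e∈)) start (⊃-wellFounded ⊥)
    where
    start : LowOn φ ⊥ 0
    start = record
      { proper = proper ; t≤∣T∣ = z≤n ; T-below = λ e e∈ → ⊥-elim (∉⊥ e∈) ; below-T = λ _ _ () }

below+above : ∀ {k} (c : Fin k) → toℕ c + (k ∸ suc (toℕ c)) ≤ k ∸ 1
below+above {suc k} c = ℕ.≤-reflexive (ℕ.m+[n∸m]≡n (ℕ.≤-pred (Fin.toℕ<n c)))

twice-below-half : ∀ c k → c < (k + 1) / 2 → c + c ≤ k ∸ 1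
twice-below-half c k c<half = ℕ.∸-monoˡ-≤ 2 (begin
  2 + (c + c)       ≡⟨ cong (2 +_) (trans (cong (c +_) (sym (ℕ.+-identityʳ c))) (ℕ.*-comm 2 c)) ⟩
  suc c * 2         ≤⟨ ℕ.*-monoˡ-≤ 2 c<half ⟩
  (k + 1) / 2 * 2   ≤⟨ m/n*n≤m (k + 1) 2 ⟩
  k + 1             ≡⟨ ℕ.+-comm k 1 ⟩
  suc k             ∎)
  where open ℕ.≤-Reasoning

module BipartitePlusBundle {n m : ℕ} (G : Multigraph n m) {k : ℕ} (col : Fin n → Bool)
  (a b : Fin n) (S : Subset m) (joins : ∀ e → e ∈ S → Joins G a b e)
  (cross : ∀ e → e ∉ S → col (end₁ G e) ≢ col (end₂ G e)) (half : ∣ S ∣ ≤ (k + 1) / 2) where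

  a∼S : ∀ e → e ∈ S → Incident G a e
  a∼S e e∈S with joins e e∈S
  ... | inj₁ (a-b , _) = inj₁ (sym a-b)
  ... | inj₂ (_ , a-b) = inj₂ (sym a-b)

  b∼S : ∀ e → e ∈ S → Incident G b e
  b∼S e e∈S with joins e e∈S
  ... | inj₁ (_ , b-a) = inj₂ (sym b-a)
  ... | inj₂ (b-a , _) = inj₁ (sym b-a)

  S-ends : ∀ e y → e ∈ S → Incident G y e → y ≡ a ⊎ y ≡ b
  S-ends e y e∈S y∼e with joins e e∈S | y∼e
  ... | inj₁ (p , _) | inj₁ q = inj₁ (trans q p)
  ... | inj₁ (_ , p) | inj₂ q = inj₂ (trans q p)
  ... | inj₂ (p , _) | inj₁ q = inj₂ (trans q p)
  ... | inj₂ (_ , p) | inj₂ q = inj₁ (trans q p)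

  side : Fin n → Side
  side x = sideOf (col x Bool.≟ col a)

  a∈D : side a ≡ D
  a∈D = sideOf-yes (col a Bool.≟ col a) refl

  both-D : ∀ {x y} → side x ≡ D → side y ≡ D → col x ≡ col y
  both-D {x} {y} x∈D y∈D = trans (sideOf-D (col x Bool.≟ col a) x∈D) (sym (sideOf-D (col y Bool.≟ col a) y∈D))

  both-U : ∀ {x y} → side x ≡ U → side y ≡ U → col x ≡ col y
  both-U {x} {y} x∈U y∈U = trans (Bool.¬-not (sideOf-U (col x Bool.≟ col a) x∈U))
                                 (sym (Bool.¬-not (sideOf-U (col y Bool.≟ col a) y∈U)))

  same-class : ∀ {g x y} → Incident G x g → Incident G y g → x ≢ y → col x ≡ col y → g ∈ S
  same-class {g} x∼g y∼g x≢y same with g ∈? S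
  ... | yes g∈S = g∈S
  ... | no  g∉S = ⊥-elim (cross g g∉S (ends-agree G col x∼g y∼g x≢y same))

  -- An edge inside U would be in S, hence have a ∈ D as an end.
  noEdgeInsideU : NoEdgeInsideU G side
  noEdgeInsideU g x y x∼g y∼g x≢y x∈U y∈U =
    x≢y (both-b (S-ends g x g∈S x∼g) x∈U (S-ends g y g∈S y∼g) y∈U)
    where
    g∈S = same-class x∼g y∼g x≢y (both-U x∈U y∈U)
    not-a : ∀ {z} → z ≡ a → side z ≢ U
    not-a refl z∈U = case trans (sym a∈D) z∈U of λ ()
    both-b : ∀ {z w} → z ≡ a ⊎ z ≡ b → side z ≡ U → w ≡ a ⊎ w ≡ b → side w ≡ U → z ≡ w
    both-b (inj₁ z≡a) z∈U _ _ = ⊥-elim (not-a z≡a z∈U)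
    both-b _ _ (inj₁ w≡a) w∈U = ⊥-elim (not-a w≡a w∈U)
    both-b (inj₂ z≡b) _ (inj₂ w≡b) _ = trans z≡b (sym w≡b)

  open LowestColours G a b S a∼S b∼S using (LowOn; lowestColours)

  module _ {φ : Fin m → Fin k} {t : ℕ} (low : LowOn φ S t) where
    open LowOn low
    open OutDegree G side φ

    -- An edge inside D is in S, so has a low colour; anything at its ends
    -- coloured below it is low too, hence in S, hence meets both ends.
    coverLower : DDEdgesCoverLower G side φ
    coverLower g h x y x∼g y∼g x≢y x∈D y∈D y∼h h<g = at-x (S-ends g x g∈S x∼g)
      where
      g∈S = same-class x∼g y∼g x≢y (both-D x∈D y∈D)
      h∼ab : Incident G a h ⊎ Incident G b h
      h∼ab with S-ends g y g∈S y∼g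
      ... | inj₁ refl = inj₁ y∼h
      ... | inj₂ refl = inj₂ y∼h
      h∈S : h ∈ S
      h∈S = below-T h h∼ab (ℕ.<-trans h<g (T-below g g∈S))
      at-x : x ≡ a ⊎ x ≡ b → Incident G x h
      at-x (inj₁ refl) = a∼S h h∈S
      at-x (inj₂ refl) = b∼S h h∈S

    budgets-fit : ∀ e s₁ s₂ → side (end₁ G e) ≡ s₁ → side (end₂ G e) ≡ s₂ →
                  budget s₁ (φ e) + budget s₂ (φ e) ≤ k ∸ 1
    budgets-fit e D D e₁∈D e₂∈D rewrite budget-D (φ e) =
      twice-below-half (toℕ (φ e)) k (ℕ.<-≤-trans (T-below e e∈S) (ℕ.≤-trans t≤∣T∣ half))
      where
      e∈S = same-class (inj₁ refl) (inj₂ refl) (noLoop G e) (both-D e₁∈D e₂∈D)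
    budgets-fit e D U _ _ rewrite budget-D (φ e) | budget-U (φ e) = below+above (φ e)
    budgets-fit e U D _ _ rewrite budget-D (φ e) | budget-U (φ e) =
      ℕ.≤-trans (ℕ.≤-reflexive (ℕ.+-comm (k ∸ suc (toℕ (φ e))) (toℕ (φ e)))) (below+above (φ e))
    budgets-fit e U U e₁∈U e₂∈U =
      ⊥-elim (noEdgeInsideU e (end₁ G e) (end₂ G e) (inj₁ refl) (inj₂ refl) (noLoop G e) e₁∈U e₂∈U)

    galvin : HasProperGalvinOrientation G k
    galvin = side , φ , proper , GalvinKernel.kernelPerfect G side φ noEdgeInsideU coverLower ,
             λ e → ℕ.≤-trans (outdeg-bound proper e) (budgets-fit e _ _ refl refl)

  orientation : Colourable G k → HasProperGalvinOrientation G k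
  orientation (_ , proper) = let (_ , _ , low) = lowestColours proper in galvin low

-- A single extra edge e₀ is a bundle of multiplicity 1 ≤ ⌊(k+1)/2⌋
-- (k ≥ 1 as e₀ receives a colour).
single-bundle : ∀ {n m} (G : Multigraph n m) {k} → Colourable G k →
                BipartitePlusEdge G → BipartitePlusMultiEdge G k
single-bundle G {k} (φ , _) (col , e₀ , cross) =
  col , end₁ G e₀ , end₂ G e₀ , ⁅ e₀ ⁆ , joins , cross′ ,
  ℕ.≤-reflexive (sym (∣⁅x⁆∣≡1 e₀)) , one≤half
  where
  joins : ∀ e → e ∈ ⁅ e₀ ⁆ → Joins G (end₁ G e₀) (end₂ G e₀) e
  joins e e∈ rewrite x∈⁅y⁆⇒x≡y e₀ e∈ = inj₁ (refl , refl)
  cross′ : ∀ e → e ∉ ⁅ e₀ ⁆ → col (end₁ G e) ≢ col (end₂ G e)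
  cross′ e e∉ = cross e (λ { refl → e∉ (x∈⁅x⁆ e₀) })
  one≤half : ∣ ⁅ e₀ ⁆ ∣ ≤ (k + 1) / 2
  one≤half rewrite ∣⁅x⁆∣≡1 e₀ =
    m≥n⇒m/n>0 (ℕ.≤-trans (s≤s 1≤k) (ℕ.≤-reflexive (ℕ.+-comm 1 k)))
    where
    1≤k : 1 ≤ k
    1≤k = ℕ.≤-trans (s≤s z≤n) (Fin.toℕ<n (φ e₀))

theorem3 : ∀ {n m : ℕ} (G : Multigraph n m) (k : ℕ) → IsChromaticIndex G k →
    (BipartitePlusEdge G → HasProperGalvinOrientation G k) ×
    (BipartitePlusMultiEdge G k → HasProperGalvinOrientation G k)
theorem3 G k (colourable , _) = orientation ∘ single-bundle G colourable , orientation
  where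
  orientation : BipartitePlusMultiEdge G k → HasProperGalvinOrientation G k
  orientation (col , a , b , S , joins , cross , _ , half) =
    BipartitePlusBundle.orientation G col a b S joins cross half colourable
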